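{- For every path $P_n$ (on $n\ge 1$ vertices), $PRC(P_n)\leq 6$.
   Context: All graphs are simple, finite and undirected. A set $S\subseteq V(G)$ is a dominating set if every vertex not in $S$ has a neighbor in $S$; $S$ is a perfect dominating set if every vertex in $V(G)\setminus S$ has exactly one neighbor in $S$. A perfect coalition in $G$ consists of two disjoint sets $V_1,V_2$ of vertices such that (i) neither $V_1$ nor $V_2$ is a dominating set of $G$; (ii) each vertex in $V(G)\setminus V_1$ has at most one neighbor in $V_1$, and each vertex in $V(G)\setminus V_2$ has at most one neighbor in $V_2$; (iii) $V_1\cup V_2$ is a perfect dominating set of $G$. A perfect coalition partition ($prc$-partition) of $G$ is a vertex partition $\pi=\{V_1,\dots,V_k\}$ such that each $V_i$ either is a singleton dominating set or forms a perfect coalition with some $V_j\in\pi$. $PRC(G)$ is the maximum cardinality of a $prc$-partition of $G$, with $PRC(G)=0$ if $G$ has no $prc$-partition. $P_n$ denotes the path on $n$ vertices. -}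

module Defs where

open import Data.Nat using (ℕ; suc)
open import Data.Fin using (Fin; toℕ)
open import Data.Product using (Σ; ∃; _×_; ∃-syntax)
open import Data.Sum using (_⊎_)
open import Relation.Nullary using (¬_)
open import Relation.Binary.PropositionalEquality using (_≡_; _≢_)

module _ {n : ℕ} (Adj : Fin n → Fin n → Set) where

  IsDominating : (Fin n → Set) → Set
  IsDominating S = ∀ v → ¬ S v → ∃[ u ] (Adj v u × S u)

  AtMostOneNbrOutside : (Fin n → Set) → Set
  AtMostOneNbrOutside S =
    ∀ v → ¬ S v → ∀ u w → Adj v u → S u → Adj v w → S w → u ≡ w

  IsPerfectDominating : (Fin n → Set) → Set
  IsPerfectDominating S =
    ∀ v → ¬ S v → ∃[ u ] (Adj v u × S u × (∀ w → Adj v w → S w → w ≡ u))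

  -- (A, B) is a perfect coalition (disjointness is supplied separately)
  IsPerfectCoalition : (Fin n → Set) → (Fin n → Set) → Set
  IsPerfectCoalition A B =
    ¬ IsDominating A × ¬ IsDominating B ×
    AtMostOneNbrOutside A × AtMostOneNbrOutside B ×
    IsPerfectDominating (λ v → A v ⊎ B v)

  -- A partition into k (nonempty) classes is a surjective labelling f : Fin n → Fin k;
  -- the i-th class is { v | f v ≡ i }.
  Class : {k : ℕ} → (Fin n → Fin k) → Fin k → Fin n → Set
  Class f i v = f v ≡ i

  IsSurjective : {k : ℕ} → (Fin n → Fin k) → Set
  IsSurjective {k} f = ∀ (i : Fin k) → ∃[ v ] (f v ≡ i)

  IsSingleton : (Fin n → Set) → Set
  IsSingleton S = ∃[ v ] (S v × (∀ w → S w → w ≡ v))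

  IsPrcPartition : {k : ℕ} → (Fin n → Fin k) → Set
  IsPrcPartition {k} f =
    IsSurjective f ×
    (∀ (i : Fin k) →
      (IsSingleton (Class f i) × IsDominating (Class f i))
      ⊎ (∃[ j ] (i ≢ j × IsPerfectCoalition (Class f i) (Class f j))))

PathAdj : (n : ℕ) → Fin n → Fin n → Set
PathAdj n i j = suc (toℕ i) ≡ toℕ j ⊎ suc (toℕ j) ≡ toℕ i

-- For n ≥ 4 no single vertex dominates P_n, so every class forms a perfect coalition with
-- another class. Vertex 0 has the single neighbour 1, so every perfect dominating union of two
-- classes contains 0 or 1: each class is c = f 0, d = f 1, or a perfect partner of c or of d.
-- As c is not dominating, some vertex x has no neighbour in c, and every perfect partner of c
-- contains x or a neighbour of x. Three distinct partners of c would either put two distinct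
-- partners B, C on adjacent vertices, and then with a third partner A the colouring must repeat
-- A B C A B C … along the rest of the path, which is finite; or they would need three distinct
-- neighbours of x. So c, and likewise d, has at most two partners, and k ≤ 6. For n ≤ 3, k ≤ n.
module Submission where

open import Defs
open import Data.Nat using (ℕ; zero; suc; _+_; _≤_; z≤n; s≤s; _≤?_)
open import Data.Nat.Properties
  using (suc-injective; ≤-trans; ≤-reflexive; ≤-pred; n≤1+n; m≤m+n; m≤n+m; +-suc; +-identityʳ;
         +-mono-≤; <⇒≢; <⇒≱; ≰⇒>; module ≤-Reasoning)
  renaming (_≟_ to _≟ℕ_)
open import Data.Fin using (Fin; toℕ; fromℕ)
import Data.Fin as Fin
open import Data.Fin.Properties using (toℕ-injective; toℕ<n; toℕ-fromℕ; any?; all?; injective⇒≤; _≟_)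
open import Data.List using (List; []; _∷_; _++_; length; lookup)
open import Data.List.Properties using (length-++)
open import Data.List.Membership.Propositional using (_∈_)
open import Data.List.Membership.Propositional.Properties using (∈-++⁺ˡ; ∈-++⁺ʳ)
open import Data.List.Relation.Unary.Any using (here; there; index)
open import Data.List.Relation.Unary.Any.Properties using (lookup-index)
open import Data.Product using (∃-syntax; _×_; _,_; proj₁; proj₂)
open import Data.Sum using (_⊎_; inj₁; inj₂; [_,_]; swap)
open import Data.Empty using (⊥; ⊥-elim)
open import Function using (_∘_; id)
open import Relation.Nullary using (¬_; Dec; yes; no; contradiction)
open import Relation.Nullary.Decidable using (_×-dec_; _⊎-dec_; _→-dec_; ¬?)
open import Relation.Unary using (Decidable)
open import Relation.Binary using () renaming (Decidable to Decidable₂)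
open import Relation.Binary.PropositionalEquality using (_≡_; _≢_; refl; sym; trans; cong; subst)

surjective⇒≤ : ∀ {n k} (f : Fin n → Fin k) → (∀ i → ∃[ v ] (f v ≡ i)) → k ≤ n
surjective⇒≤ {n} {k} f surj = injective⇒≤ {f = section} λ {i} {j} eq →
  trans (sym (proj₂ (surj i))) (trans (cong f eq) (proj₂ (surj j)))
  where
  section : Fin k → Fin n
  section i = proj₁ (surj i)

covered⇒≤ : ∀ {k} (xs : List (Fin k)) → (∀ i → i ∈ xs) → k ≤ length xs
covered⇒≤ {k} xs covered = injective⇒≤ {f = position} λ {i} {j} eq →
  trans (lookup-index (covered i)) (trans (cong (lookup xs) eq) (sym (lookup-index (covered j))))
  where
  position : Fin k → Fin (length xs)
  position i = index (covered i)

NoThreeDistinct : ∀ {k} → (Fin k → Set) → Set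
NoThreeDistinct P = ∀ {a b c} → P a → P b → P c → a ≢ b → a ≢ c → b ≢ c → ⊥

no-three-distinct⇒covered-by-two : ∀ {k} {P : Fin k → Set} → Decidable P → NoThreeDistinct P →
  ∃[ xs ] (length xs ≤ 2 × (∀ {i} → P i → i ∈ xs))
no-three-distinct⇒covered-by-two {P = P} P? none with any? P?
... | no ¬a = [] , z≤n , λ Pi → contradiction (_ , Pi) ¬a
... | yes (a , Pa) with any? (λ b → P? b ×-dec ¬? (b ≟ a))
...   | no ¬b = a ∷ [] , s≤s z≤n , member
  where
  member : ∀ {i} → P i → i ∈ a ∷ []
  member {i} Pi with i ≟ a
  ... | yes i≡a = here i≡a
  ... | no i≢a = contradiction (i , Pi , i≢a) ¬b
...   | yes (b , Pb , b≢a) = a ∷ b ∷ [] , s≤s (s≤s z≤n) , member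
  where
  member : ∀ {i} → P i → i ∈ a ∷ b ∷ []
  member {i} Pi with i ≟ a | i ≟ b
  ... | yes i≡a | _ = here i≡a
  ... | no _ | yes i≡b = there (here i≡b)
  ... | no i≢a | no i≢b = ⊥-elim (none Pa Pb Pi (b≢a ∘ sym) (i≢a ∘ sym) (i≢b ∘ sym))

Undominated : ∀ {n} → (Fin n → Fin n → Set) → (Fin n → Set) → Fin n → Set
Undominated Adj S x = ¬ S x × (∀ u → Adj x u → ¬ S u)

perfect⇒dominating : ∀ {n} {Adj : Fin n → Fin n → Set} {S : Fin n → Set} →
  IsPerfectDominating Adj S → IsDominating Adj S
perfect⇒dominating pd v v∉S with pd v v∉S
... | u , v~u , u∈S , _ = u , v~u , u∈S

module _ {n} {Adj : Fin n → Fin n → Set} (adj? : Decidable₂ Adj) {S : Fin n → Set} (S? : Decidable S) where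

  undominated-vertex : ¬ IsDominating Adj S → ∃[ x ] Undominated Adj S x
  undominated-vertex ¬dom with any? (λ x → ¬? (S? x) ×-dec all? (λ u → adj? x u →-dec ¬? (S? u)))
  ... | yes found = found
  ... | no none = contradiction dominating ¬dom
    where
    dominating : IsDominating Adj S
    dominating v v∉S with any? (λ u → adj? v u ×-dec S? u)
    ... | yes nbr = nbr
    ... | no ¬nbr = contradiction (v , v∉S , λ u v~u u∈S → ¬nbr (u , v~u , u∈S)) none

  isPerfectDominating? : Dec (IsPerfectDominating Adj S)
  isPerfectDominating? =
    all? λ v → ¬? (S? v) →-dec any? λ u →
      adj? v u ×-dec S? u ×-dec all? λ w → adj? v w →-dec S? w →-dec w ≟ u

module Labelling {n k} (Adj : Fin n → Fin n → Set) (f : Fin n → Fin k) where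

  Partner : Fin k → Fin k → Set
  Partner j i = i ≢ j × IsPerfectDominating Adj (λ v → f v ≡ i ⊎ f v ≡ j)

  partner? : Decidable₂ Adj → ∀ j → Decidable (Partner j)
  partner? adj? j i = ¬? (i ≟ j) ×-dec isPerfectDominating? adj? (λ v → (f v ≟ i) ⊎-dec (f v ≟ j))

  PerfectCoalitionWithSome : Fin k → Set
  PerfectCoalitionWithSome i = ∃[ j ] (i ≢ j × IsPerfectCoalition Adj (λ v → f v ≡ i) (λ v → f v ≡ j))

  coalition⇒partner : ∀ {i} → PerfectCoalitionWithSome i → ∃[ j ] Partner j i
  coalition⇒partner (j , i≢j , _ , _ , _ , _ , pd) = j , i≢j , pd

  coalition⇒non-dominating : ∀ {i} → PerfectCoalitionWithSome i → ¬ IsDominating Adj (λ v → f v ≡ i)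
  coalition⇒non-dominating (_ , _ , ¬dom , _) = ¬dom

  self-or-partner : ∀ {i j w} → Partner j i → f w ≡ i ⊎ f w ≡ j → i ≡ f w ⊎ Partner (f w) i
  self-or-partner _       (inj₁ w∈i) = inj₁ (sym w∈i)
  self-or-partner {i} pji (inj₂ w∈j) = inj₂ (subst (λ c → Partner c i) (sym w∈j) pji)

  partner-meets-closed-nbhd : ∀ {i j x} → Undominated Adj (λ v → f v ≡ j) x → Partner j i →
    f x ≡ i ⊎ ∃[ u ] (Adj x u × f u ≡ i)
  partner-meets-closed-nbhd {i} {x = x} (x∉j , nbrs∉j) (_ , pd) with f x ≟ i
  ... | yes x∈i = inj₁ x∈i
  ... | no x∉i with pd x [ x∉i , x∉j ]
  ...   | u , x~u , inj₁ u∈i , _ = inj₂ (u , x~u , u∈i)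
  ...   | u , x~u , inj₂ u∈j , _ = contradiction u∈j (nbrs∉j u x~u)

pathAdj? : ∀ {n} → Decidable₂ (PathAdj n)
pathAdj? u v = (suc (toℕ u) ≟ℕ toℕ v) ⊎-dec (suc (toℕ v) ≟ℕ toℕ u)

successor-unique : ∀ {n} {u v w : Fin n} → suc (toℕ u) ≡ toℕ v → suc (toℕ u) ≡ toℕ w → v ≡ w
successor-unique u→v u→w = toℕ-injective (trans (sym u→v) u→w)

predecessor-unique : ∀ {n} {u v w : Fin n} → suc (toℕ u) ≡ toℕ w → suc (toℕ v) ≡ toℕ w → u ≡ v
predecessor-unique u→w v→w = toℕ-injective (suc-injective (trans u→w (sym v→w)))

path-degree≤2 : ∀ {n} {x a b c : Fin n} → PathAdj n x a → PathAdj n x b → PathAdj n x c →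
  a ≡ b ⊎ a ≡ c ⊎ b ≡ c
path-degree≤2 (inj₁ x→a) (inj₁ x→b) _          = inj₁ (successor-unique x→a x→b)
path-degree≤2 (inj₂ a→x) (inj₂ b→x) _          = inj₁ (predecessor-unique a→x b→x)
path-degree≤2 (inj₁ x→a) (inj₂ _)   (inj₁ x→c) = inj₂ (inj₁ (successor-unique x→a x→c))
path-degree≤2 (inj₂ a→x) (inj₁ _)   (inj₂ c→x) = inj₂ (inj₁ (predecessor-unique a→x c→x))
path-degree≤2 (inj₁ _)   (inj₂ b→x) (inj₂ c→x) = inj₂ (inj₂ (predecessor-unique b→x c→x))
path-degree≤2 (inj₂ _)   (inj₁ x→b) (inj₁ x→c) = inj₂ (inj₂ (successor-unique x→b x→c))

closed-nbr⇒≤suc : ∀ {n} {a b : Fin n} → a ≡ b ⊎ PathAdj n a b → toℕ a ≤ suc (toℕ b)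
closed-nbr⇒≤suc (inj₁ refl)        = n≤1+n _
closed-nbr⇒≤suc (inj₂ (inj₁ a→b)) = ≤-trans (n≤1+n _) (≤-trans (≤-reflexive a→b) (n≤1+n _))
closed-nbr⇒≤suc (inj₂ (inj₂ b→a)) = ≤-reflexive (sym b→a)

closed-nbr-sym : ∀ {n} {a b : Fin n} → a ≡ b ⊎ PathAdj n a b → b ≡ a ⊎ PathAdj n b a
closed-nbr-sym (inj₁ a≡b) = inj₁ (sym a≡b)
closed-nbr-sym (inj₂ a~b) = inj₂ (swap a~b)

singleton-dominating⇒≤3 : ∀ {n} {S : Fin n → Set} →
  IsSingleton (PathAdj n) S → IsDominating (PathAdj n) S → n ≤ 3
singleton-dominating⇒≤3 {zero} _ _ = z≤n
singleton-dominating⇒≤3 {suc m} (v , _ , unique) dom = s≤s (begin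
  m                  ≡⟨ sym (toℕ-fromℕ m) ⟩
  toℕ (fromℕ m)      ≤⟨ closed-nbr⇒≤suc (near (fromℕ m)) ⟩
  suc (toℕ v)        ≤⟨ s≤s (closed-nbr⇒≤suc (closed-nbr-sym (near Fin.zero))) ⟩
  2                  ∎)
  where
  open ≤-Reasoning
  near : ∀ a → a ≡ v ⊎ PathAdj (suc m) a v
  near a with a ≟ v
  ... | yes a≡v = inj₁ a≡v
  ... | no a≢v with dom a (a≢v ∘ unique a)
  ...   | u , a~u , u∈S = inj₂ (subst (PathAdj (suc m) a) (unique u u∈S) a~u)

dominating-first-edge : ∀ {m} {S : Fin (suc (suc m)) → Set} →
  IsDominating (PathAdj _) S → ¬ S Fin.zero → S (Fin.suc Fin.zero)
dominating-first-edge dom 0∉S with dom Fin.zero 0∉S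
... | Fin.zero              , inj₁ () , _
... | Fin.zero              , inj₂ () , _
... | Fin.suc Fin.zero      , _       , 1∈S = 1∈S
... | Fin.suc (Fin.suc _)   , inj₁ () , _
... | Fin.suc (Fin.suc _)   , inj₂ () , _

module PathLabelling {n k} (f : Fin n → Fin k) where

  open Labelling (PathAdj n) f public

  Rainbow : Fin k → Fin k → Fin k → Fin k → Set
  Rainbow j A B C = Partner j A × Partner j B × Partner j C × A ≢ B × B ≢ C × C ≢ A

  rainbow-rotate : ∀ {j A B C} → Rainbow j A B C → Rainbow j B C A
  rainbow-rotate (pA , pB , pC , A≢B , B≢C , C≢A) = pB , pC , pA , B≢C , C≢A , A≢B

  private
    outside : ∀ {w X Y Z} → f w ≡ Z → Z ≢ X → Z ≢ Y → ¬ (f w ≡ X ⊎ f w ≡ Y)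
    outside w∈Z Z≢X Z≢Y = [ Z≢X ∘ trans (sym w∈Z) , Z≢Y ∘ trans (sym w∈Z) ]

    two-apart : ∀ {u v w : Fin n} → suc (toℕ u) ≡ toℕ v → suc (toℕ v) ≡ toℕ w → u ≢ w
    two-apart u→v v→w u≡w =
      <⇒≢ (≤-trans (≤-reflexive u→v) (≤-trans (n≤1+n _) (≤-reflexive v→w))) (cong toℕ u≡w)

  -- w's unique neighbour in A ∪ j cannot be v ∈ B, and it cannot lie in j either,
  -- since then w would have two neighbours v and z in B ∪ j.
  rainbow-step : ∀ {j A B C v w} → Rainbow j A B C → suc (toℕ v) ≡ toℕ w → f v ≡ B → f w ≡ C →
    ∃[ z ] (suc (toℕ w) ≡ toℕ z × f z ≡ A)
  rainbow-step {j} {A} {v = v} {w}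
    ((_ , pdA) , (B≢j , pdB) , (C≢j , _) , A≢B , B≢C , C≢A) v→w v∈B w∈C with pdA w (outside w∈C C≢A C≢j)
  ... | z , inj₁ w→z , inj₁ z∈A , _ = z , w→z , z∈A
  ... | z , inj₂ z→w , z∈A∪j , _ =
    contradiction (subst (λ u → f u ≡ A ⊎ f u ≡ j) (predecessor-unique z→w v→w) z∈A∪j)
                  (outside v∈B (A≢B ∘ sym) B≢j)
  ... | z , inj₁ w→z , inj₂ z∈j , _ with pdB w (outside w∈C (B≢C ∘ sym) C≢j)
  ...   | _ , _ , _ , unique =
    contradiction (trans (unique v (inj₂ v→w) (inj₁ v∈B)) (sym (unique z (inj₁ w→z) (inj₂ z∈j))))
                  (two-apart v→w w→z)

  -- m bounds the room left on the path to the right of w.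
  no-rainbow-run-within : ∀ m {j A B C v w} → Rainbow j A B C →
    suc (toℕ v) ≡ toℕ w → f v ≡ B → f w ≡ C → n ≤ toℕ w + m → ⊥
  no-rainbow-run-within zero {w = w} _ _ _ _ n≤w+0 =
    <⇒≱ (toℕ<n w) (≤-trans n≤w+0 (≤-reflexive (+-identityʳ _)))
  no-rainbow-run-within (suc m) {w = w} r v→w v∈B w∈C n≤w+1+m with rainbow-step r v→w v∈B w∈C
  ... | z , w→z , z∈A = no-rainbow-run-within m (rainbow-rotate r) w→z w∈C z∈A
    (≤-trans n≤w+1+m (≤-reflexive (trans (+-suc (toℕ w) m) (cong (_+ m) w→z))))

  no-rainbow-run : ∀ {j A B C v w} → Rainbow j A B C → suc (toℕ v) ≡ toℕ w → f v ≡ B → f w ≡ C → ⊥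
  no-rainbow-run {w = w} r v→w v∈B w∈C = no-rainbow-run-within n r v→w v∈B w∈C (m≤n+m n (toℕ w))

  rainbow-edge-closure : ∀ {j A B C v w} → Partner j B → Partner j C → B ≢ C →
    PathAdj n v w → f v ≡ B → f w ≡ C → Partner j A → A ≡ B ⊎ A ≡ C
  rainbow-edge-closure {A = A} {B} {C} pB pC B≢C v~w v∈B w∈C pA with A ≟ B | A ≟ C | v~w
  ... | yes A≡B | _       | _         = inj₁ A≡B
  ... | no _    | yes A≡C | _         = inj₂ A≡C
  ... | no A≢B  | no A≢C  | inj₁ v→w =
    ⊥-elim (no-rainbow-run (pA , pB , pC , A≢B , B≢C , A≢C ∘ sym) v→w v∈B w∈C)
  ... | no A≢B  | no A≢C  | inj₂ w→v =
    ⊥-elim (no-rainbow-run (pA , pC , pB , A≢C , B≢C ∘ sym , A≢B ∘ sym) w→v w∈C v∈B)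

  partners-of-class-at : ∀ {j x A B C} → Undominated (PathAdj n) (λ v → f v ≡ j) x →
    Partner j A → f x ≡ A → Partner j B → B ≢ A → Partner j C → C ≡ A ⊎ C ≡ B
  partners-of-class-at und pA x∈A pB B≢A pC with partner-meets-closed-nbhd und pB
  ... | inj₁ x∈B = contradiction (trans (sym x∈B) x∈A) B≢A
  ... | inj₂ (u , x~u , u∈B) = rainbow-edge-closure pA pB (B≢A ∘ sym) x~u x∈A u∈B pC

  no-three-partners : ∀ {j x} → Undominated (PathAdj n) (λ v → f v ≡ j) x → NoThreeDistinct (Partner j)
  no-three-partners und pA pB pC A≢B A≢C B≢C
    with partner-meets-closed-nbhd und pA
       | partner-meets-closed-nbhd und pB
       | partner-meets-closed-nbhd und pC
  ... | inj₁ x∈A | _ | _ = [ A≢C ∘ sym , B≢C ∘ sym ] (partners-of-class-at und pA x∈A pB (A≢B ∘ sym) pC)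
  ... | _ | inj₁ x∈B | _ = [ B≢C ∘ sym , A≢C ∘ sym ] (partners-of-class-at und pB x∈B pA A≢B pC)
  ... | _ | _ | inj₁ x∈C = [ B≢C , A≢B ∘ sym ] (partners-of-class-at und pC x∈C pA A≢C pB)
  ... | inj₂ (a , x~a , a∈A) | inj₂ (b , x~b , b∈B) | inj₂ (c , x~c , c∈C) =
    [ A≢B ∘ same-class a∈A b∈B , [ A≢C ∘ same-class a∈A c∈C , B≢C ∘ same-class b∈B c∈C ] ]
      (path-degree≤2 x~a x~b x~c)
    where
    same-class : ∀ {u v U V} → f u ≡ U → f v ≡ V → u ≡ v → U ≡ V
    same-class u∈U v∈V refl = trans (sym u∈U) v∈V

  self-and-partners-covered-by-three : ∀ {j} → ¬ IsDominating (PathAdj n) (λ v → f v ≡ j) →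
    ∃[ xs ] (length xs ≤ 3 × (∀ {i} → i ≡ j ⊎ Partner j i → i ∈ xs))
  self-and-partners-covered-by-three {j} ¬dom with undominated-vertex pathAdj? (λ v → f v ≟ j) ¬dom
  ... | _ , und with no-three-distinct⇒covered-by-two (partner? pathAdj? j) (no-three-partners und)
  ...   | xs , |xs|≤2 , covers = j ∷ xs , s≤s |xs|≤2 , [ here , there ∘ covers ]

  prc⇒perfect-coalitions : 4 ≤ n → IsPrcPartition (PathAdj n) f → ∀ i → PerfectCoalitionWithSome i
  prc⇒perfect-coalitions 4≤n (_ , classes) i =
    [ (λ (single , dom) → contradiction (singleton-dominating⇒≤3 single dom) (<⇒≱ 4≤n)) , id ] (classes i)

module _ {m k} (f : Fin (suc (suc m)) → Fin k) where

  open PathLabelling f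

  first-edge-partners : ∀ {i j} → Partner j i →
    (i ≡ f Fin.zero ⊎ Partner (f Fin.zero) i) ⊎ (i ≡ f (Fin.suc Fin.zero) ⊎ Partner (f (Fin.suc Fin.zero)) i)
  first-edge-partners {i} {j} pji with (f Fin.zero ≟ i) ⊎-dec (f Fin.zero ≟ j)
  ... | yes 0∈i∪j = inj₁ (self-or-partner pji 0∈i∪j)
  ... | no 0∉i∪j =
    inj₂ (self-or-partner pji (dominating-first-edge (perfect⇒dominating (proj₂ pji)) 0∉i∪j))

  perfect-coalitions⇒size≤6 : (∀ i → PerfectCoalitionWithSome i) → k ≤ 6
  perfect-coalitions⇒size≤6 coalition
    with xs , |xs|≤3 , in-xs ←
           self-and-partners-covered-by-three (coalition⇒non-dominating (coalition (f Fin.zero)))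
    with ys , |ys|≤3 , in-ys ←
           self-and-partners-covered-by-three (coalition⇒non-dominating (coalition (f (Fin.suc Fin.zero))))
    = begin
    k                       ≤⟨ covered⇒≤ (xs ++ ys) covered ⟩
    length (xs ++ ys)       ≡⟨ length-++ xs ⟩
    length xs + length ys   ≤⟨ +-mono-≤ |xs|≤3 |ys|≤3 ⟩
    6                       ∎
    where
    open ≤-Reasoning
    covered : ∀ i → i ∈ xs ++ ys
    covered i = [ ∈-++⁺ˡ ∘ in-xs , ∈-++⁺ʳ xs ∘ in-ys ]
      (first-edge-partners (proj₂ (coalition⇒partner (coalition i))))

corollary3p2 : (n : ℕ) → 1 ≤ n → (k : ℕ) → (f : Fin n → Fin k) →
    IsPrcPartition (PathAdj n) f → k ≤ 6
corollary3p2 n _ k f prc with 4 ≤? n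
... | no 4≰n = ≤-trans (surjective⇒≤ f (proj₁ prc)) (≤-trans (≤-pred (≰⇒> 4≰n)) (m≤m+n 3 3))
... | yes 4≤n@(s≤s (s≤s _)) = perfect-coalitions⇒size≤6 f (prc⇒perfect-coalitions 4≤n prc)
  where open PathLabelling f
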